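{- Suppose $\mathrm{M}\subset\mathbb{N}^n$ is finite with constant sum $r\ge3$. If $\mathrm{M}$ is connected and $\partial_i(\mathrm{M})$ is M-convex for every $i$, then $\mathrm{M}$ is M-convex.
   Context: $\mathrm{M}$ has constant sum $r$ if $\alpha_1+\dots+\alpha_n=r$ for all $\alpha\in\mathrm{M}$. $\partial_i(\mathrm{M})=\{\alpha-e_i:\alpha\in\mathrm{M},\ \alpha-e_i\in\mathbb{N}^n\}$, $e_i$ the standard basis vector. For $r\ge2$, $\mathrm{M}$ is connected if there is no proper subset $A\subset[n]$ such that $\{\alpha\in\mathrm{M}:\alpha_i=0\ \forall i\in A\}$ and $\{\alpha\in\mathrm{M}:\alpha_i=0\ \forall i\in[n]\setminus A\}$ partition $\mathrm{M}$ into two nonempty sets. A finite $\mathrm{M}\subset\mathbb{N}^n$ is M-convex if whenever $\alpha,\beta\in\mathrm{M}$ and $\alpha_i>\beta_i$, there is $j$ with $\beta_j>\alpha_j$ and $\alpha-e_i+e_j\in\mathrm{M}$. -}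

module Defs where

open import Data.Nat using (ℕ; zero; suc; _+_; _∸_; _<_)
open import Data.Fin using (Fin)
open import Data.Fin.Subset using (Subset; _∈_; _∉_; ⊤)
open import Data.Vec using (Vec; lookup; _[_]%=_)
open import Data.Vec.Relation.Unary.All using () renaming (All to AllV)
open import Data.List using (List)
import Data.List.Membership.Propositional as LM
open import Data.Product using (Σ; ∃; _×_; _,_)
open import Relation.Binary.PropositionalEquality using (_≡_)
open import Relation.Nullary using (¬_)

Pt : ℕ → Set
Pt n = Vec ℕ n

PtSet : ℕ → Set
PtSet n = List (Pt n)

∣_∣ₚ : ∀ {n} → Pt n → ℕ
∣_∣ₚ = Data.Vec.sum

-- α - e_i  (only used where α_i ≥ 1) and α + e_j
dec : ∀ {n} → Pt n → Fin n → Pt n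
dec α i = α [ i ]%= (λ x → x ∸ 1)

inc : ∀ {n} → Pt n → Fin n → Pt n
inc α j = α [ j ]%= suc

ConstantSum : ∀ {n} → PtSet n → ℕ → Set
ConstantSum M r = ∀ α → α LM.∈ M → ∣ α ∣ₚ ≡ r

-- membership in ∂_i(M) = { α - e_i : α ∈ M, α - e_i ∈ ℕ^n }
-- β ∈ ∂_i(M)  iff  β + e_i ∈ M
_∈∂[_]_ : ∀ {n} → Pt n → Fin n → PtSet n → Set
β ∈∂[ i ] M = inc β i LM.∈ M

MConvexP : ∀ {n} → (Pt n → Set) → Set
MConvexP {n} S =
  ∀ α β → S α → S β → ∀ (i : Fin n) → lookup β i < lookup α i →
    ∃ λ (j : Fin n) → lookup α j < lookup β j × S (inc (dec α i) j)

MConvex : ∀ {n} → PtSet n → Set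
MConvex M = MConvexP (λ α → α LM.∈ M)

VanishOn : ∀ {n} → Subset n → Pt n → Set
VanishOn {n} A α = ∀ (i : Fin n) → i ∈ A → lookup α i ≡ 0

Splits : ∀ {n} → PtSet n → Subset n → Set
Splits {n} M A =
  (∀ α → α LM.∈ M → (VanishOn A α × ¬ VanishOn (Data.Fin.Subset.∁ A) α)
                   Data.Sum.⊎ (VanishOn (Data.Fin.Subset.∁ A) α × ¬ VanishOn A α))
  × (∃ λ α → α LM.∈ M × VanishOn A α)
  × (∃ λ α → α LM.∈ M × VanishOn (Data.Fin.Subset.∁ A) α)
  where import Data.Sum

Connected : ∀ {n} → PtSet n → Set
Connected {n} M = ∀ (A : Subset n) → A ≢ ⊤ → ¬ Splits M A
  where open import Relation.Binary.PropositionalEquality using (_≢_)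

module Submission where

-- Let supp α be the set of coordinates where α is positive. If α, β ∈ M share a coordinate k,
-- the exchange for α, β is the exchange for α - e_k, β - e_k in the M-convex set ∂_k M, shifted
-- back by e_k. Consequently, if ρ, δ ∈ M share a coordinate, every t ∈ supp δ can be swapped into
-- ρ (ρ - e_i + e_t ∈ M for some i ∈ supp ρ): exchange δ step by step towards ρ, decreasing
-- Σ (δ_z ∸ ρ_z), until δ - e_t ≤ ρ; then sums force the exchange for ρ, δ to bring in t.
-- Because r ≥ 3, α - e_i - e_i' is still nonzero and shares a coordinate with anything built
-- from it, so the set U of coordinates that can be swapped into α is a union of supports of
-- points of M. If supp α and supp β are disjoint, either some t ∈ supp β lies in U, and one
-- more convexity step in ∂_t M yields the exchange, or each support lies inside or outside U
-- and U disconnects M.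

open import Defs
open import Data.Nat using (ℕ; zero; suc; _∸_; _≤_; _<_; z≤n; s≤s; s≤s⁻¹; z<s; _<?_)
open import Data.Nat.Properties
open import Data.Nat.Induction using (<-wellFounded)
open import Data.Fin using (Fin; zero; suc) renaming (_≟_ to _≟ᶠ_)
open import Data.Fin.Properties using (any?)
open import Data.Fin.Subset using (Subset; ∁; ⊤) renaming (_∈_ to _∈ˢ_)
open import Data.Fin.Subset.Properties using (x∈∁p⇒x∉p; x∉p⇒x∈∁p; ∈⊤)
open import Data.Vec using (Vec; []; _∷_; lookup; updateAt; tabulate; zipWith; sum)
open import Data.Vec.Properties
  using (lookup∘updateAt; lookup∘updateAt′; updateAt-updateAt; updateAt-id-local;
         updateAt-commutes; lookup-zipWith; lookup∘tabulate; []=⇒lookup; lookup⇒[]=; ≡-dec)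
open import Data.List.Membership.Propositional using (_∈_)
open import Data.Product using (∃; _×_; _,_; proj₁; proj₂)
open import Data.Sum using (_⊎_; inj₁; inj₂)
open import Function using (_∘_)
open import Induction.WellFounded using (Acc; acc)
open import Relation.Binary.PropositionalEquality
open import Relation.Nullary using (¬_; yes; no; does; contradiction; ¬?)
open import Relation.Nullary.Decidable using (_×-dec_; dec-true; decidable-stable)
open import Relation.Unary using (Decidable)

private variable
  n : ℕ

infixl 10 _!_
_!_ : Pt n → Fin n → ℕ
v ! i = lookup v i

_∈supp_ : Fin n → Pt n → Set
k ∈supp v = 0 < v ! k

∉supp⇒≡0 : ∀ (v : Pt n) k → ¬ k ∈supp v → v ! k ≡ 0
∉supp⇒≡0 v k k∉v = n≤0⇒n≡0 (≮⇒≥ k∉v)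

∉supp⇒< : ∀ (u v : Pt n) k → ¬ k ∈supp u → k ∈supp v → u ! k < v ! k
∉supp⇒< u v k k∉u k∈v = subst (_< v ! k) (sym (∉supp⇒≡0 u k k∉u)) k∈v

lookup-inc-≡ : ∀ (v : Pt n) i → inc v i ! i ≡ suc (v ! i)
lookup-inc-≡ v i = lookup∘updateAt i v

lookup-inc-≢ : ∀ (v : Pt n) {i z} → i ≢ z → inc v i ! z ≡ v ! z
lookup-inc-≢ v i≢z = lookup∘updateAt′ _ _ (i≢z ∘ sym) v

lookup-dec-≡ : ∀ (v : Pt n) i → dec v i ! i ≡ v ! i ∸ 1
lookup-dec-≡ v i = lookup∘updateAt i v

lookup-dec-≢ : ∀ (v : Pt n) {i z} → i ≢ z → dec v i ! z ≡ v ! z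
lookup-dec-≢ v i≢z = lookup∘updateAt′ _ _ (i≢z ∘ sym) v

lookup-inc-≥ : ∀ (v : Pt n) i z → v ! z ≤ inc v i ! z
lookup-inc-≥ v i z with i ≟ᶠ z
... | yes refl = ≤-trans (n≤1+n _) (≤-reflexive (sym (lookup-inc-≡ v i)))
... | no i≢z = ≤-reflexive (sym (lookup-inc-≢ v i≢z))

lookup-dec-≤ : ∀ (v : Pt n) i z → dec v i ! z ≤ v ! z
lookup-dec-≤ v i z with i ≟ᶠ z
... | yes refl = ≤-trans (≤-reflexive (lookup-dec-≡ v i)) (m∸n≤m _ 1)
... | no i≢z = ≤-reflexive (lookup-dec-≢ v i≢z)

lookup-dec-< : ∀ (v : Pt n) i → i ∈supp v → dec v i ! i < v ! i
lookup-dec-< v i i∈v = subst (_< v ! i) (sym (lookup-dec-≡ v i)) (∸-monoʳ-< z<s i∈v)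

lookup-dec-mono : ∀ (u v : Pt n) i z → u ! z ≤ v ! z → dec u i ! z ≤ dec v i ! z
lookup-dec-mono u v i z u≤v with i ≟ᶠ z
... | yes refl = subst₂ _≤_ (sym (lookup-dec-≡ u i)) (sym (lookup-dec-≡ v i)) (∸-monoˡ-≤ 1 u≤v)
... | no i≢z = subst₂ _≤_ (sym (lookup-dec-≢ u i≢z)) (sym (lookup-dec-≢ v i≢z)) u≤v

∈supp-inc : ∀ (v : Pt n) t → t ∈supp inc v t
∈supp-inc v t = subst (0 <_) (sym (lookup-inc-≡ v t)) z<s

dec-preserves-< : ∀ (u v : Pt n) k i → k ∈supp u → u ! i < v ! i → dec u k ! i < dec v k ! i
dec-preserves-< u v k i k∈u u<v with k ≟ᶠ i
... | yes refl = subst₂ _<_ (sym (lookup-dec-≡ u k)) (sym (lookup-dec-≡ v k)) (∸-monoˡ-< u<v k∈u)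
... | no k≢i = subst₂ _<_ (sym (lookup-dec-≢ u k≢i)) (sym (lookup-dec-≢ v k≢i)) u<v

dec-reflects-< : ∀ (u v : Pt n) k j → dec u k ! j < dec v k ! j → u ! j < v ! j
dec-reflects-< u v k j lt with k ≟ᶠ j
... | yes refl = ≰⇒> λ v≤u → <⇒≱ lt (subst₂ _≤_ (sym (lookup-dec-≡ v k)) (sym (lookup-dec-≡ u k)) (∸-monoˡ-≤ 1 v≤u))
... | no k≢j = subst₂ _<_ (lookup-dec-≢ u k≢j) (lookup-dec-≢ v k≢j) lt

updateAt-self-comm : ∀ {A : Set} (f : A → A) (xs : Vec A n) i j →
  updateAt (updateAt xs i f) j f ≡ updateAt (updateAt xs j f) i f
updateAt-self-comm f xs i j with i ≟ᶠ j
... | yes refl = refl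
... | no i≢j = updateAt-commutes j i (i≢j ∘ sym) xs

inc-dec-cancel : ∀ (v : Pt n) k → k ∈supp v → inc (dec v k) k ≡ v
inc-dec-cancel v k k∈v =
  trans (updateAt-updateAt k v) (updateAt-id-local k v (m+[n∸m]≡n k∈v))

exchange-through : ∀ (v : Pt n) i j k → k ∈supp dec v i →
  inc (inc (dec (dec v k) i) j) k ≡ inc (dec v i) j
exchange-through v i j k k∈v′ = begin
  inc (inc (dec (dec v k) i) j) k ≡⟨ cong (λ w → inc (inc w j) k) (updateAt-self-comm _ v k i) ⟩
  inc (inc (dec (dec v i) k) j) k ≡⟨ updateAt-self-comm suc (dec (dec v i) k) j k ⟩
  inc (inc (dec (dec v i) k) k) j ≡⟨ cong (λ w → inc w j) (inc-dec-cancel (dec v i) k k∈v′) ⟩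
  inc (dec v i) j                 ∎
  where open ≡-Reasoning

sum-mono-≤ : ∀ (u v : Vec ℕ n) → (∀ z → u ! z ≤ v ! z) → sum u ≤ sum v
sum-mono-≤ []      []      _   = z≤n
sum-mono-≤ (_ ∷ u) (_ ∷ v) u≤v = +-mono-≤ (u≤v zero) (sum-mono-≤ u v (u≤v ∘ suc))

sum-mono-< : ∀ (u v : Vec ℕ n) → (∀ z → u ! z ≤ v ! z) → ∀ x → u ! x < v ! x → sum u < sum v
sum-mono-< (_ ∷ u) (_ ∷ v) u≤v zero    lt = +-mono-<-≤ lt (sum-mono-≤ u v (u≤v ∘ suc))
sum-mono-< (_ ∷ u) (_ ∷ v) u≤v (suc x) lt = +-mono-≤-< (u≤v zero) (sum-mono-< u v (u≤v ∘ suc) x lt)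

sum-≡⇒surplus : ∀ (u v : Pt n) t → sum u ≡ sum v → u ! t < v ! t → ∃ λ i → v ! i < u ! i
sum-≡⇒surplus u v t eq lt with any? (λ i → v ! i <? u ! i)
... | yes surplus = surplus
... | no no-surplus =
  contradiction (sum-mono-< u v (λ z → ≮⇒≥ (λ v<u → no-surplus (z , v<u))) t lt) (<-irrefl eq)

sum-dec-≥ : ∀ (v : Pt n) i → sum v ≤ suc (sum (dec v i))
sum-dec-≥ (zero  ∷ v) zero    = n≤1+n _
sum-dec-≥ (suc _ ∷ v) zero    = ≤-refl
sum-dec-≥ (x     ∷ v) (suc i) = ≤-trans (+-monoʳ-≤ x (sum-dec-≥ v i)) (≤-reflexive (+-suc x _))

sum-pos⇒∃∈supp : ∀ (v : Pt n) → 0 < sum v → ∃ (_∈supp v)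
sum-pos⇒∃∈supp (zero  ∷ v) pos with sum-pos⇒∃∈supp v pos
... | k , k∈v = suc k , k∈v
sum-pos⇒∃∈supp (suc _ ∷ v) pos = zero , z<s

dist : Pt n → Pt n → ℕ
dist δ ρ = sum (zipWith _∸_ δ ρ)

dist-exchange-< : ∀ (ρ δ : Pt n) x y → ρ ! x < δ ! x → δ ! y < ρ ! y →
                  dist (inc (dec δ x) y) ρ < dist δ ρ
dist-exchange-< ρ δ x y ρₓ<δₓ δy<ρy = sum-mono-< (zipWith _∸_ δ′ ρ) (zipWith _∸_ δ ρ) pointwise x strict
  where
  δ′ = inc (dec δ x) y
  y≢x : y ≢ x
  y≢x refl = <-asym ρₓ<δₓ δy<ρy
  pointwise : ∀ z → zipWith _∸_ δ′ ρ ! z ≤ zipWith _∸_ δ ρ ! z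
  pointwise z rewrite lookup-zipWith _∸_ z δ′ ρ | lookup-zipWith _∸_ z δ ρ with y ≟ᶠ z
  ... | yes refl = ≤-trans (≤-reflexive (m≤n⇒m∸n≡0 (subst (_≤ ρ ! y) (sym (lookup-inc-≡ (dec δ x) y))
                                                       (<-≤-trans (s≤s (lookup-dec-≤ δ x y)) δy<ρy)))) z≤n
  ... | no y≢z = ∸-monoˡ-≤ (ρ ! z) (subst (_≤ δ ! z) (sym (lookup-inc-≢ (dec δ x) y≢z)) (lookup-dec-≤ δ x z))
  strict : zipWith _∸_ δ′ ρ ! x < zipWith _∸_ δ ρ ! x
  strict rewrite lookup-zipWith _∸_ x δ′ ρ | lookup-zipWith _∸_ x δ ρ
               | lookup-inc-≢ (dec δ x) y≢x | lookup-dec-≡ δ x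
               | ∸-+-assoc (δ ! x) 1 (ρ ! x) = ∸-monoʳ-< (n<1+n _) ρₓ<δₓ

∈supp-dec : ∀ (u v : Pt n) z i → z ∈supp v → u ! i < dec v z ! i → z ∈supp dec v i
∈supp-dec u v z i z∈v lt with i ≟ᶠ z
... | yes refl = ≤-<-trans z≤n lt
... | no i≢z = subst (0 <_) (sym (lookup-dec-≢ v i≢z)) z∈v

inc-gain : ∀ (u v : Pt n) j s → u ! s ≤ v ! s → v ! s < inc u j ! s → j ≡ s
inc-gain u v j s u≤v v<u′ with j ≟ᶠ s
... | yes j≡s = j≡s
... | no j≢s = contradiction (subst (v ! s <_) (lookup-inc-≢ u j≢s) v<u′) (≤⇒≯ u≤v)

toSubset : {P : Fin n → Set} → Decidable P → Subset n
toSubset P? = tabulate (does ∘ P?)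

∈-toSubset⁺ : ∀ {P : Fin n → Set} (P? : Decidable P) {t} → P t → t ∈ˢ toSubset P?
∈-toSubset⁺ P? {t} p = lookup⇒[]= t _ (trans (lookup∘tabulate (does ∘ P?) t) (dec-true (P? t) p))

∈-toSubset⁻ : ∀ {P : Fin n → Set} (P? : Decidable P) {t} → t ∈ˢ toSubset P? → P t
∈-toSubset⁻ P? {t} t∈P with P? t | trans (sym (lookup∘tabulate (does ∘ P?) t)) ([]=⇒lookup t∈P)
... | yes p | _ = p

monochromatic-supports⇒¬Connected : ∀ {M : PtSet n} {U : Fin n → Set} → Decidable U →
  (∀ {δ} → δ ∈ M → ∃ (_∈supp δ)) →
  (∀ {δ} → δ ∈ M → (∀ t → t ∈supp δ → U t) ⊎ (∀ t → t ∈supp δ → ¬ U t)) →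
  (∃ λ α → α ∈ M × ∀ t → t ∈supp α → U t) →
  (∃ λ β → β ∈ M × ∀ t → t ∈supp β → ¬ U t) →
  ¬ Connected M
monochromatic-supports⇒¬Connected {n} {M} {U} U? nonempty monochromatic
  (α , α∈M , α⊆U) (β , β∈M , β∩U) connected =
  connected X X≢⊤ (split , (α , α∈M , vanishOn α α⊆U) , (β , β∈M , vanishOn∁ β β∩U))
  where
  X : Subset n
  X = toSubset (¬? ∘ U?)
  ∈X⇒¬U : ∀ {t} → t ∈ˢ X → ¬ U t
  ∈X⇒¬U = ∈-toSubset⁻ (¬? ∘ U?)
  ¬U⇒∈X : ∀ {t} → ¬ U t → t ∈ˢ X
  ¬U⇒∈X = ∈-toSubset⁺ (¬? ∘ U?)
  ∈∁X⇒U : ∀ {t} → t ∈ˢ ∁ X → U t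
  ∈∁X⇒U {t} t∈∁X = decidable-stable (U? t) (x∈∁p⇒x∉p t∈∁X ∘ ¬U⇒∈X)
  U⇒∈∁X : ∀ {t} → U t → t ∈ˢ ∁ X
  U⇒∈∁X u = x∉p⇒x∈∁p (λ t∈X → ∈X⇒¬U t∈X u)
  vanishOn : ∀ δ → (∀ t → t ∈supp δ → U t) → VanishOn X δ
  vanishOn δ δ⊆U t t∈X = ∉supp⇒≡0 δ t (∈X⇒¬U t∈X ∘ δ⊆U t)
  vanishOn∁ : ∀ δ → (∀ t → t ∈supp δ → ¬ U t) → VanishOn (∁ X) δ
  vanishOn∁ δ δ∩U t t∈∁X = ∉supp⇒≡0 δ t (λ t∈δ → δ∩U t t∈δ (∈∁X⇒U t∈∁X))
  ¬vanishOn : ∀ {A} δ k → k ∈supp δ → k ∈ˢ A → ¬ VanishOn A δ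
  ¬vanishOn δ k k∈δ k∈A vanishes = <-irrefl (sym (vanishes k k∈A)) k∈δ
  split : ∀ δ → δ ∈ M → (VanishOn X δ × ¬ VanishOn (∁ X) δ) ⊎ (VanishOn (∁ X) δ × ¬ VanishOn X δ)
  split δ δ∈M with monochromatic δ∈M | nonempty δ∈M
  ... | inj₁ δ⊆U | k , k∈δ = inj₁ (vanishOn δ δ⊆U , ¬vanishOn δ k k∈δ (U⇒∈∁X (δ⊆U k k∈δ)))
  ... | inj₂ δ∩U | k , k∈δ = inj₂ (vanishOn∁ δ δ∩U , ¬vanishOn δ k k∈δ (¬U⇒∈X (δ∩U k k∈δ)))
  X≢⊤ : X ≢ ⊤
  X≢⊤ X≡⊤ with nonempty α∈M
  ... | k , k∈α = ∈X⇒¬U (subst (k ∈ˢ_) (sym X≡⊤) ∈⊤) (α⊆U k k∈α)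

Exchange : PtSet n → Pt n → Pt n → Fin n → Set
Exchange M α β i = ∃ λ j → α ! j < β ! j × inc (dec α i) j ∈ M

Swappable : PtSet n → Pt n → Fin n → Set
Swappable M α t = ∃ λ i → i ∈supp α × inc (dec α i) t ∈ M

swappable? : ∀ (M : PtSet n) α → Decidable (Swappable M α)
swappable? {n} M α t = any? (λ i → (0 <? α ! i) ×-dec (inc (dec α i) t ∈? M))
  where open import Data.List.Membership.DecPropositional (≡-dec {n = n} Data.Nat._≟_) using (_∈?_)

module _ {M : PtSet n} where

  dec-∈∂ : ∀ {α} k → α ∈ M → k ∈supp α → dec α k ∈∂[ k ] M
  dec-∈∂ {α} k α∈M k∈α = subst (_∈ M) (sym (inc-dec-cancel α k k∈α)) α∈M

  ∈supp⇒swappable : ∀ {α} t → α ∈ M → t ∈supp α → Swappable M α t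
  ∈supp⇒swappable t α∈M t∈α = t , t∈α , dec-∈∂ t α∈M t∈α

  module _ {r} (sum≡r : ConstantSum M r) (3≤r : 3 ≤ r) where

    supp-nonempty : ∀ {α} → α ∈ M → ∃ (_∈supp α)
    supp-nonempty {α} α∈M = sum-pos⇒∃∈supp α (≤-trans (s≤s z≤n) (≤-trans 3≤r (≤-reflexive (sym (sum≡r α α∈M)))))

    supp-survives-two-removals : ∀ {α} → α ∈ M → ∀ a b → ∃ (_∈supp dec (dec α a) b)
    supp-survives-two-removals {α} α∈M a b = sum-pos⇒∃∈supp (dec (dec α a) b) (s≤s⁻¹ (s≤s⁻¹ (begin
      3                                  ≤⟨ 3≤r ⟩
      r                                  ≡⟨ sum≡r α α∈M ⟨
      sum α                              ≤⟨ sum-dec-≥ α a ⟩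
      suc (sum (dec α a))                ≤⟨ s≤s (sum-dec-≥ (dec α a) b) ⟩
      suc (suc (sum (dec (dec α a) b)))  ∎)))
      where open ≤-Reasoning

  module _ (∂-convex : ∀ i → MConvexP (λ β → β ∈∂[ i ] M)) where

    common-support-exchange : ∀ {α γ} k i → α ∈ M → γ ∈ M → k ∈supp α → k ∈supp γ →
                              γ ! i < α ! i → Exchange M α γ i
    common-support-exchange {α} {γ} k i α∈M γ∈M k∈α k∈γ γᵢ<αᵢ
      with ∂-convex k (dec α k) (dec γ k) (dec-∈∂ k α∈M k∈α) (dec-∈∂ k γ∈M k∈γ) i γ′ᵢ<α′ᵢ
      where γ′ᵢ<α′ᵢ = dec-preserves-< γ α k i k∈γ γᵢ<αᵢ
    ... | j , α′ⱼ<γ′ⱼ , mem =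
      j , dec-reflects-< α γ k j α′ⱼ<γ′ⱼ , subst (_∈ M) (exchange-through α i j k k∈α′) mem
      where k∈α′ = ∈supp-dec (dec γ k) α k i k∈α (dec-preserves-< γ α k i k∈γ γᵢ<αᵢ)

    module _ {r} (sum≡r : ConstantSum M r) where

      dominated⇒swappable : ∀ {ρ δ} k t → ρ ∈ M → δ ∈ M → k ∈supp ρ → k ∈supp δ →
                            ρ ! t < δ ! t → (∀ x → dec δ t ! x ≤ ρ ! x) → Swappable M ρ t
      dominated⇒swappable {ρ} {δ} k t ρ∈M δ∈M k∈ρ k∈δ ρₜ<δₜ δ′≤ρ
        with sum-≡⇒surplus ρ δ t (trans (sum≡r ρ ρ∈M) (sym (sum≡r δ δ∈M))) ρₜ<δₜ
      ... | i , δᵢ<ρᵢ with common-support-exchange k i ρ∈M δ∈M k∈ρ k∈δ δᵢ<ρᵢ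
      ... | j , ρⱼ<δⱼ , ρ′∈M with t ≟ᶠ j
      ... | yes refl = i , ≤-<-trans z≤n δᵢ<ρᵢ , ρ′∈M
      ... | no t≢j = contradiction (subst (ρ ! j <_) (sym (lookup-dec-≢ δ t≢j)) ρⱼ<δⱼ) (≤⇒≯ (δ′≤ρ j))

      common-support⇒swappable : ∀ {ρ δ} k t → ρ ∈ M → δ ∈ M → k ∈supp ρ → k ∈supp δ →
                                 t ∈supp δ → Swappable M ρ t
      common-support⇒swappable {ρ} {δ} k t ρ∈M δ∈M k∈ρ k∈δ t∈δ with 0 <? ρ ! t
      ... | yes t∈ρ = ∈supp⇒swappable t ρ∈M t∈ρ
      ... | no t∉ρ = descend δ (<-wellFounded (dist δ ρ)) δ∈M k k∈ρ k∈δ t∈δ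
        where
        descend : ∀ δ → Acc _<_ (dist δ ρ) → δ ∈ M → ∀ k → k ∈supp ρ → k ∈supp δ → t ∈supp δ →
                  Swappable M ρ t
        descend δ (acc closer) δ∈M k k∈ρ k∈δ t∈δ with any? (λ x → ρ ! x <? dec δ t ! x)
        ... | no δ′≯ρ = dominated⇒swappable k t ρ∈M δ∈M k∈ρ k∈δ (∉supp⇒< ρ δ t t∉ρ t∈δ)
                          (λ x → ≮⇒≥ (λ ρₓ<δ′ₓ → δ′≯ρ (x , ρₓ<δ′ₓ)))
        ... | yes (x , ρₓ<δ′ₓ) =
          let ρₓ<δₓ = <-≤-trans ρₓ<δ′ₓ (lookup-dec-≤ δ t x)
              (y , δy<ρy , δ″∈M) = common-support-exchange k x δ∈M ρ∈M k∈δ k∈ρ ρₓ<δₓ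
              t∈δ″ = <-≤-trans (∈supp-dec ρ δ t x t∈δ ρₓ<δ′ₓ) (lookup-inc-≥ (dec δ x) y t)
          in descend (inc (dec δ x) y) (closer (dist-exchange-< ρ δ x y ρₓ<δₓ δy<ρy)) δ″∈M
                     y (≤-<-trans z≤n δy<ρy) (∈supp-inc (dec δ x) y) t∈δ″

      module _ (3≤r : 3 ≤ r) where

        swappable-closed : ∀ {α δ} s t → α ∈ M → Swappable M α s → δ ∈ M → s ∈supp δ → t ∈supp δ →
                           Swappable M α t
        swappable-closed {α} {δ} s t α∈M (i , _ , α′∈M) δ∈M s∈δ t∈δ =
          let α′ = inc (dec α i) s
              (i′ , _ , ε∈M) = common-support⇒swappable s t α′∈M δ∈M (∈supp-inc (dec α i) s) s∈δ t∈δ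
              (k , k∈α″) = supp-survives-two-removals sum≡r 3≤r α∈M i i′
              k∈α = <-≤-trans k∈α″ (≤-trans (lookup-dec-≤ (dec α i) i′ k) (lookup-dec-≤ α i k))
              k∈ε = <-≤-trans k∈α″ (≤-trans (lookup-dec-mono (dec α i) α′ i′ k (lookup-inc-≥ (dec α i) s k))
                                            (lookup-inc-≥ (dec α′ i′) t k))
          in common-support⇒swappable k t α∈M ε∈M k∈α k∈ε (∈supp-inc (dec α′ i′) t)

        swappable-monochromatic : ∀ {α δ} → α ∈ M → δ ∈ M →
          (∀ t → t ∈supp δ → Swappable M α t) ⊎ (∀ t → t ∈supp δ → ¬ Swappable M α t)
        swappable-monochromatic {α} {δ} α∈M δ∈M with any? (λ s → (0 <? δ ! s) ×-dec swappable? M α s)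
        ... | yes (s , s∈δ , α⇝s) = inj₁ (λ t → swappable-closed s t α∈M α⇝s δ∈M s∈δ)
        ... | no none = inj₂ (λ t t∈δ α⇝t → none (t , t∈δ , α⇝t))

        disjoint-support-exchange : ∀ {α β} j₀ i → α ∈ M → β ∈ M → (∀ k → k ∈supp α → ¬ k ∈supp β) →
                                    j₀ ∈supp β → Swappable M α j₀ → β ! i < α ! i → Exchange M α β i
        disjoint-support-exchange {α} {β} j₀ i α∈M β∈M disjoint j₀∈β (i₀ , _ , α′∈M) βᵢ<αᵢ with i₀ ≟ᶠ i
        ... | yes refl = j₀ , ∉supp⇒< α β j₀ (λ j₀∈α → disjoint j₀ j₀∈α j₀∈β) j₀∈β , α′∈M
        ... | no i₀≢i with ∂-convex j₀ (dec α i₀) (dec β j₀) α′∈M (dec-∈∂ j₀ β∈M j₀∈β) i β′ᵢ<α′ᵢ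
          where β′ᵢ<α′ᵢ = ≤-<-trans (lookup-dec-≤ β j₀ i) (subst (β ! i <_) (sym (lookup-dec-≢ α i₀≢i)) βᵢ<αᵢ)
        ... | j , α′ⱼ<β′ⱼ , δ∈M =
          let (s , αₛ<δₛ , mem) = common-support-exchange k i α∈M δ∈M k∈α k∈δ δᵢ<αᵢ
          in s , ∉supp⇒< α β s (λ s∈α → disjoint s s∈α (s∈β s αₛ<δₛ)) (s∈β s αₛ<δₛ) , mem
          where
          ε = dec (dec α i₀) i
          δ = inc (inc ε j) j₀
          i∈α : i ∈supp α
          i∈α = ≤-<-trans z≤n βᵢ<αᵢ
          j∈β : j ∈supp β
          j∈β = <-≤-trans (≤-<-trans z≤n α′ⱼ<β′ⱼ) (lookup-dec-≤ β j₀ j)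
          ≢i : ∀ {x} → x ∈supp β → x ≢ i
          ≢i x∈β refl = disjoint _ i∈α x∈β
          survivor = supp-survives-two-removals sum≡r 3≤r α∈M i₀ i
          k = proj₁ survivor
          k∈ε : k ∈supp ε
          k∈ε = proj₂ survivor
          k∈α : k ∈supp α
          k∈α = <-≤-trans k∈ε (≤-trans (lookup-dec-≤ (dec α i₀) i k) (lookup-dec-≤ α i₀ k))
          k∈δ : k ∈supp δ
          k∈δ = <-≤-trans k∈ε (≤-trans (lookup-inc-≥ ε j k) (lookup-inc-≥ (inc ε j) j₀ k))
          δᵢ<αᵢ : δ ! i < α ! i
          δᵢ<αᵢ = subst (_< α ! i) (sym (trans (lookup-inc-≢ (inc ε j) (≢i j₀∈β)) (lookup-inc-≢ ε (≢i j∈β))))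
                    (<-≤-trans (lookup-dec-< (dec α i₀) i (subst (0 <_) (sym (lookup-dec-≢ α i₀≢i)) i∈α))
                               (lookup-dec-≤ α i₀ i))
          s∈β : ∀ s → α ! s < δ ! s → s ∈supp β
          s∈β s αₛ<δₛ with j₀ ≟ᶠ s
          ... | yes refl = j₀∈β
          ... | no j₀≢s = subst (_∈supp β) (inc-gain ε α j s (≤-trans (lookup-dec-≤ (dec α i₀) i s) (lookup-dec-≤ α i₀ s))
                                   (subst (α ! s <_) (lookup-inc-≢ (inc ε j) j₀≢s) αₛ<δₛ)) j∈β

proposition8p6 : ∀ (n r : ℕ) (M : PtSet n) → 3 ≤ r → ConstantSum M r →
    Connected M → (∀ (i : Fin n) → MConvexP (λ β → β ∈∂[ i ] M)) →
    MConvex M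
proposition8p6 n r M 3≤r sum≡r connected ∂-convex α β α∈M β∈M i βᵢ<αᵢ
  with any? (λ k → (0 <? α ! k) ×-dec (0 <? β ! k))
... | yes (k , k∈α , k∈β) = common-support-exchange ∂-convex k i α∈M β∈M k∈α k∈β βᵢ<αᵢ
... | no no-common with any? (λ t → (0 <? β ! t) ×-dec swappable? M α t)
... | yes (t , t∈β , α⇝t) =
  disjoint-support-exchange ∂-convex sum≡r 3≤r t i α∈M β∈M
    (λ k k∈α k∈β → no-common (k , k∈α , k∈β)) t∈β α⇝t βᵢ<αᵢ
... | no unreachable = contradiction connected
  (monochromatic-supports⇒¬Connected (swappable? M α) (supp-nonempty sum≡r 3≤r)
    (swappable-monochromatic ∂-convex sum≡r 3≤r α∈M)
    (α , α∈M , λ t → ∈supp⇒swappable t α∈M)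
    (β , β∈M , λ t t∈β α⇝t → unreachable (t , t∈β , α⇝t)))
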